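{- $[x] \, R^f [y] \iff (\forall B \in \Sigma) \, \vartriangle B \in \Sigma \mbox{ and } y \models B \mbox{ imply } x \models \vartriangle B$.
   Context: IntGC is the logic over intuitionistic propositional logic with additional unary connectives $\vartriangle$, $\triangledown$, closed under substitution, modus ponens and the rules: $A \to \triangledown B$ provable iff $\vartriangle A \to B$ provable (so $B\to\triangledown\vartriangle B$ and $\vartriangle\triangledown B\to B$ are provable). A Kripke model $(X,\le,R,v)$ has $\le$ a preorder, $R$ a relation with $({\ge}\circ R\circ{\ge})\subseteq R$, intuitionistic satisfaction for $\neg,\to,\vee,\wedge$, and $x \models \vartriangle A$ iff some $y$ has $x\,R\,y$ and $y\models A$; $x\models \triangledown A$ iff every $y$ with $y\,R\,x$ satisfies $A$. Fix a formula $A$ and such a model. Let $\Gamma = \mathrm{Sub}(A) \cup \{ \triangledown \vartriangle B \mid \vartriangle B \in \mathrm{Sub}(A) \} \cup \{ \vartriangle \triangledown B \mid \triangledown B \in \mathrm{Sub}(A) \}$ and $\Sigma = \mathrm{Sub}(A) \cup \{ (\triangledown \vartriangle)^n \triangledown B , \vartriangle (\triangledown \vartriangle)^n \triangledown B \mid n \geq 0, \triangledown B \in \Gamma \} \cup \{ (\vartriangle \triangledown)^n \vartriangle B , \triangledown (\vartriangle \triangledown)^n \vartriangle B \mid n \geq 0, \vartriangle B \in \Gamma \}$. Define $x \sim y$ iff for every $B \in \Sigma$, $x \models B$ iff $y \models B$; $[x]$ is the class of $x$. Define $[x]\,R^f\,[y]$ iff for all $B\in\Sigma$, if $\triangledown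 B\in\Sigma$ and $y\models\triangledown B$ then $x\models B$. -}

module Defs where

open import Data.Nat using (ℕ; zero; suc)
open import Data.Product using (Σ; ∃; _×_; _,_)
open import Data.Sum using (_⊎_)
open import Relation.Nullary using (¬_)
open import Level using (suc; _⊔_) renaming (zero to lzero)

infixr 6 _∧'_
infixr 5 _∨'_
infixr 4 _⇒_
data Form : Set where
  var   : ℕ → Form
  ¬'_   : Form → Form
  _∧'_  : Form → Form → Form
  _∨'_  : Form → Form → Form
  _⇒_   : Form → Form → Form
  △_    : Form → Form
  ▽_    : Form → Form

data Sub : Form → Form → Set where
  here : ∀ {A} → Sub A A
  ¬s   : ∀ {A B} → Sub A B → Sub (¬' A) B
  ∧l   : ∀ {A₁ A₂ B} → Sub A₁ B → Sub (A₁ ∧' A₂) B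
  ∧r   : ∀ {A₁ A₂ B} → Sub A₂ B → Sub (A₁ ∧' A₂) B
  ∨l   : ∀ {A₁ A₂ B} → Sub A₁ B → Sub (A₁ ∨' A₂) B
  ∨r   : ∀ {A₁ A₂ B} → Sub A₂ B → Sub (A₁ ∨' A₂) B
  ⇒l   : ∀ {A₁ A₂ B} → Sub A₁ B → Sub (A₁ ⇒ A₂) B
  ⇒r   : ∀ {A₁ A₂ B} → Sub A₂ B → Sub (A₁ ⇒ A₂) B
  △s   : ∀ {A B} → Sub A B → Sub (△ A) B
  ▽s   : ∀ {A B} → Sub A B → Sub (▽ A) B

data InΓ (A : Form) : Form → Set where
  sub  : ∀ {B} → Sub A B → InΓ A B
  ▽△   : ∀ {B} → Sub A (△ B) → InΓ A (▽ (△ B))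
  △▽   : ∀ {B} → Sub A (▽ B) → InΓ A (△ (▽ B))

iter : ℕ → (Form → Form) → Form → Form
iter zero    f C = C
iter (suc n) f C = f (iter n f C)

▽△^ : ℕ → Form → Form
▽△^ n = iter n (λ C → ▽ (△ C))

△▽^ : ℕ → Form → Form
△▽^ n = iter n (λ C → △ (▽ C))

-- Σ = Sub(A) ∪ {(▽△)^n ▽B, △(▽△)^n ▽B | n ≥ 0, ▽B ∈ Γ}
--            ∪ {(△▽)^n △B, ▽(△▽)^n △B | n ≥ 0, △B ∈ Γ}
data InΣ (A : Form) : Form → Set where
  sub  : ∀ {B} → Sub A B → InΣ A B
  dn₁  : ∀ {B} (n : ℕ) → InΓ A (▽ B) → InΣ A (▽△^ n (▽ B))
  dn₂  : ∀ {B} (n : ℕ) → InΓ A (▽ B) → InΣ A (△ (▽△^ n (▽ B)))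
  up₁  : ∀ {B} (n : ℕ) → InΓ A (△ B) → InΣ A (△▽^ n (△ B))
  up₂  : ∀ {B} (n : ℕ) → InΓ A (△ B) → InΣ A (▽ (△▽^ n (△ B)))

-- Kripke models (X, ≤, R, v): ≤ a preorder, (≥ ∘ R ∘ ≥) ⊆ R,
-- v persistent (upward closed along ≤).
record Model : Set₁ where
  field
    X      : Set
    _≤_    : X → X → Set
    ≤-refl  : ∀ {x} → x ≤ x
    ≤-trans : ∀ {x y z} → x ≤ y → y ≤ z → x ≤ z
    R      : X → X → Set
    R-cl   : ∀ {x x' y' y} → x' ≤ x → R x' y' → y ≤ y' → R x y
    v      : X → ℕ → Set
    v-mono : ∀ {x y p} → x ≤ y → v x p → v y p

module _ (M : Model) where
  open Model M

  Sat : X → Form → Set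
  Sat x (var p)  = v x p
  Sat x (¬' A)   = ∀ y → x ≤ y → ¬ Sat y A
  Sat x (A ∧' B) = Sat x A × Sat x B
  Sat x (A ∨' B) = Sat x A ⊎ Sat x B
  Sat x (A ⇒ B)  = ∀ y → x ≤ y → Sat y A → Sat y B
  Sat x (△ A)    = Σ X λ y → R x y × Sat y A
  Sat x (▽ A)    = ∀ y → R y x → Sat y A

  _∼_ : Form → X → X → Set
  _∼_ A x y = ∀ B → InΣ A B → (Sat x B → Sat y B) × (Sat y B → Sat x B)

  -- [x] R^f [y], stated on representatives (the condition depends only on
  -- the ∼-classes of x and y, since B, ▽B ∈ Σ):
  -- for all B ∈ Σ, if ▽B ∈ Σ and y ⊨ ▽B then x ⊨ B.
  Rf : Form → X → X → Set
  Rf A x y = ∀ B → InΣ A B → InΣ A (▽ B) → Sat y (▽ B) → Sat x B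

-- △ ⊣ ▽ holds pointwise in every model (y ⊨ B gives y ⊨ ▽△B, and x ⊨ △▽B gives
-- x ⊨ B), and Σ is closed under prefixing △B with ▽ and ▽B with △.  So the
-- condition defining R^f at ▽(△B) is the △-condition at B, and the
-- △-condition at ▽B is the R^f-condition at B.
module Submission where

open import Defs
open import Data.Nat using (zero; suc)
open import Data.Product using (_×_; _,_)
open import Relation.Binary.PropositionalEquality using (_≡_; refl)

module _ {A : Form} where

  ▽△-closed : ∀ {B} → InΣ A (△ B) → InΣ A (▽ (△ B))
  ▽△-closed p = go p refl
    where
    -- The index is generalised because Agda cannot unify △▽^ n (△ B') with △ B
    -- before n is split.
    go : ∀ {F B} → InΣ A F → F ≡ △ B → InΣ A (▽ (△ B))
    go (sub p)         refl = up₂ 0 (sub p)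
    go (dn₁ zero _)    ()
    go (dn₁ (suc _) _) ()
    go (dn₂ n g)       refl = dn₁ (suc n) g
    go (up₁ zero g)    refl = up₂ 0 g
    go (up₁ (suc n) g) refl = up₂ (suc n) g
    go (up₂ _ _)       ()

  △▽-closed : ∀ {B} → InΣ A (▽ B) → InΣ A (△ (▽ B))
  △▽-closed p = go p refl
    where
    go : ∀ {F B} → InΣ A F → F ≡ ▽ B → InΣ A (△ (▽ B))
    go (sub p)         refl = dn₂ 0 (sub p)
    go (dn₁ zero g)    refl = dn₂ 0 g
    go (dn₁ (suc n) g) refl = dn₂ (suc n) g
    go (dn₂ _ _)       ()
    go (up₁ zero _)    ()
    go (up₁ (suc _) _) ()
    go (up₂ n g)       refl = up₁ (suc n) g

module _ (M : Model) where

  sat-▽△-unit : ∀ {y} B → Sat M y B → Sat M y (▽ (△ B))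
  sat-▽△-unit {y} B yB z zRy = y , zRy , yB

  sat-△▽-counit : ∀ {x} B → Sat M x (△ (▽ B)) → Sat M x B
  sat-△▽-counit {x} B (z , xRz , z▽B) = z▽B x xRz

lemma3p7 : (A : Form) (M : Model) (x y : Model.X M) →
    (Rf M A x y →
      (∀ B → InΣ A B → InΣ A (△ B) → Sat M y B → Sat M x (△ B)))
    × ((∀ B → InΣ A B → InΣ A (△ B) → Sat M y B → Sat M x (△ B)) →
      Rf M A x y)
lemma3p7 A M x y = Rf⇒△ , △⇒Rf
  where
  Rf⇒△ : Rf M A x y → ∀ B → InΣ A B → InΣ A (△ B) → Sat M y B → Sat M x (△ B)
  Rf⇒△ rf B _ △B∈Σ yB = rf (△ B) △B∈Σ (▽△-closed △B∈Σ) (sat-▽△-unit M B yB)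

  △⇒Rf : (∀ B → InΣ A B → InΣ A (△ B) → Sat M y B → Sat M x (△ B)) → Rf M A x y
  △⇒Rf h B _ ▽B∈Σ y▽B = sat-△▽-counit M B (h (▽ B) ▽B∈Σ (△▽-closed ▽B∈Σ) y▽B)
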